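{- Let $G=(A\cup B,E)$ be a finite simple bipartite graph with $B=\{u_1,\dots,u_{n_2}\}$. For $1\le i\le \lceil \log_2 n_2\rceil$ define $g_i:A\cup B\to\mathbb{R}$ by $g_i(u_j)=0$ if the $i$-th bit of the binary representation of $j$ is $0$, $g_i(u_j)=2$ if it is $1$, and $g_i(v)=1$ for every $v\in A$. Let $J_i$ be the graph on $A\cup B$ in which distinct $u,v$ are adjacent iff $|g_i(u)-g_i(v)|\le 1$, and let $H_2=\bigcap_{i} J_i$ (the graph on $A\cup B$ whose edge set is the intersection of the edge sets of the $J_i$). Then $H_2$ is a supergraph of $G$, and for all distinct $u,v\in B$, $(u,v)\notin E(H_2)$.
   Context: A graph $G'$ with $V(G')=V(G)$ is a supergraph of $G$ if $E(G)\subseteq E(G')$. Bits are indexed starting from the least significant bit as bit $1$. -}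

module Defs where

open import Data.Nat using (ℕ; zero; suc; _+_; _^_; _≤_; ∣_-_∣; _/_; _%_)
open import Data.Nat.Logarithm using (⌈log₂_⌉)
open import Data.Fin using (Fin; toℕ)
open import Data.Sum using (_⊎_; inj₁; inj₂)
open import Data.Product using (_×_)
open import Data.Empty using (⊥)
open import Relation.Nullary using (¬_)
open import Relation.Binary.PropositionalEquality using (_≡_; _≢_)

-- Vertex set A ∪ B with |A| = n₁, |B| = n₂ (disjoint union).
-- inj₂ k stands for u_j with j = toℕ k + 1 (so B = {u_1,…,u_{n₂}}).
V : ℕ → ℕ → Set
V n₁ n₂ = Fin n₁ ⊎ Fin n₂

record Graph (X : Set) : Set₁ where
  field
    Adj   : X → X → Set
    sym   : ∀ {x y} → Adj x y → Adj y x
    irrefl : ∀ {x} → ¬ Adj x x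
open Graph public

IsBipartiteAB : ∀ {n₁ n₂} → Graph (V n₁ n₂) → Set
IsBipartiteAB {n₁} {n₂} G =
  (∀ (a a' : Fin n₁) → ¬ Adj G (inj₁ a) (inj₁ a')) ×
  (∀ (b b' : Fin n₂) → ¬ Adj G (inj₂ b) (inj₂ b'))

-- i-th bit of j, bits indexed from 1 at the least significant bit.
-- bit 1 j = j mod 2 ; bit (i+1) j = bit i ⌊j/2⌋ ; bit 0 j unused (= 0).
bit : ℕ → ℕ → ℕ
bit zero j = 0
bit (suc zero) j = j % 2
bit (suc (suc i)) j = bit (suc i) (j / 2)

g : ∀ {n₁ n₂} → ℕ → V n₁ n₂ → ℕ
g i (inj₁ a) = 1
g i (inj₂ k) with bit i (suc (toℕ k))
... | zero = 0
... | suc _ = 2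

JAdj : ∀ {n₁ n₂} → ℕ → V n₁ n₂ → V n₁ n₂ → Set
JAdj i u v = (u ≢ v) × (∣ g i u - g i v ∣ ≤ 1)

H₂Adj : ∀ {n₁ n₂} → V n₁ n₂ → V n₁ n₂ → Set
H₂Adj {n₁} {n₂} u v =
  (u ≢ v) × (∀ (i : ℕ) → 1 ≤ i → i ≤ ⌈log₂ n₂ ⌉ → JAdj i u v)

IsSupergraphOf : ∀ {X : Set} → (X → X → Set) → Graph X → Set
IsSupergraphOf {X} Adj' G = ∀ (x y : X) → Adj G x y → Adj' x y

module Submission where

-- Every g_i takes the value 1 on A and a value in {0, 2} on B,
-- so a vertex of A is within distance 1 of every vertex of B; since G is
-- bipartite, every edge of G joins A to B and hence lies in every J_i, i.e.
-- in H₂.  For u_j, u_j' ∈ B we have g_i(u_j) = 2·(i-th bit of j), so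
-- |g_i(u_j) - g_i(u_j')| ≤ 1 forces the i-th bits of j and j' to agree.  An
-- H₂-edge between u_j and u_j' therefore makes j and j' agree on their lowest
-- k = ⌈log₂ n₂⌉ bits, whence j ≡ j' (mod 2^k); as 1 ≤ j, j' ≤ n₂ ≤ 2^k this
-- gives j = j'.

open import Defs
open import Data.Nat using (ℕ; zero; suc; _+_; _*_; _∸_; _^_; _≤_; _<_; z≤n; s≤s; ∣_-_∣; _/_; _%_; ⌈_/2⌉)
open import Data.Nat.Properties
open import Data.Nat.DivMod using (m≡m%n+[m/n]*n; m%n<n; /-monoˡ-≤)
open import Data.Nat.Induction using (<-wellFounded)
open import Data.Nat.Logarithm using (⌈log₂_⌉)
open import Data.Nat.Logarithm.Core using (⌈log2⌉)
open import Data.Nat.Tactic.RingSolver using (solve-∀)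
open import Induction.WellFounded using (Acc; acc)
open import Data.Fin using (Fin; toℕ)
open import Data.Fin.Properties using (toℕ<n; toℕ-injective)
open import Data.Sum using (inj₁; inj₂)
open import Data.Product using (_×_; _,_; ∃)
open import Data.Empty using (⊥-elim)
open import Relation.Nullary using (¬_)
open import Relation.Binary.PropositionalEquality
  using (_≡_; _≢_; refl; cong; cong₂; trans; subst; module ≡-Reasoning)
  renaming (sym to ≡-sym)

-- The ceiling logarithm is large enough: n ≤ 2^⌈log₂ n⌉.  Proved by
-- well-founded recursion along the defining recursion of ⌈log2⌉, using
-- n ≤ 2·⌈n/2⌉ and ⌈log₂ n⌉ = 1 + ⌈log₂ ⌈n/2⌉⌉ for n ≥ 2.

n≤⌈n/2⌉+⌈n/2⌉ : ∀ n → n ≤ ⌈ n /2⌉ + ⌈ n /2⌉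
n≤⌈n/2⌉+⌈n/2⌉ n = subst (_≤ ⌈ n /2⌉ + ⌈ n /2⌉) (⌊n/2⌋+⌈n/2⌉≡n n)
  (+-monoˡ-≤ ⌈ n /2⌉ (⌊n/2⌋≤⌈n/2⌉ n))

n≤2^⌈log2⌉ : ∀ n (rec : Acc _<_ n) → n ≤ 2 ^ ⌈log2⌉ n rec
n≤2^⌈log2⌉ zero _ = z≤n
n≤2^⌈log2⌉ (suc zero) _ = ≤-refl
n≤2^⌈log2⌉ (suc (suc n)) (acc rs) = begin
    suc (suc n)   ≤⟨ n≤⌈n/2⌉+⌈n/2⌉ (suc (suc n)) ⟩
    half + half   ≤⟨ +-mono-≤ ih (≤-trans ih (≤-reflexive (≡-sym (+-identityʳ _)))) ⟩
    2 ^ suc (⌈log2⌉ half (rs (⌈n/2⌉<n n))) ∎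
  where
  open ≤-Reasoning
  half = ⌈ suc (suc n) /2⌉
  ih = n≤2^⌈log2⌉ half (rs (⌈n/2⌉<n n))

n≤2^⌈log₂n⌉ : ∀ n → n ≤ 2 ^ ⌈log₂ n ⌉
n≤2^⌈log₂n⌉ n = n≤2^⌈log2⌉ n (<-wellFounded n)

bit<2 : ∀ i j → bit i j < 2
bit<2 zero j = s≤s z≤n
bit<2 (suc zero) j = m%n<n j 2
bit<2 (suc (suc i)) j = bit<2 (suc i) (j / 2)

AgreeBelow : ℕ → ℕ → ℕ → Set
AgreeBelow k j j' = ∀ i → 1 ≤ i → i ≤ k → bit i j ≡ bit i j'

-- Agreement on the lowest k bits means j' - j is a multiple of 2^k.
-- Induction on k: strip the lowest bit (j = j % 2 + ⌊j/2⌋·2) and recurse.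
agree⇒congruent : ∀ k j j' → AgreeBelow k j j' → j ≤ j' → ∃ λ t → j' ≡ j + t * 2 ^ k
agree⇒congruent zero j j' _ j≤j' =
  j' ∸ j , trans (≡-sym (m+[n∸m]≡n j≤j')) (cong (j +_) (≡-sym (*-identityʳ (j' ∸ j))))
agree⇒congruent (suc k) j j' agree j≤j'
  with agree⇒congruent k (j / 2) (j' / 2) agreeHigher (/-monoˡ-≤ 2 j≤j')
  where
  agreeHigher : AgreeBelow k (j / 2) (j' / 2)
  agreeHigher (suc i) _ i≤k = agree (suc (suc i)) (s≤s z≤n) (s≤s i≤k)
... | t , j'/2≡ = t , (begin
    j'                             ≡⟨ m≡m%n+[m/n]*n j' 2 ⟩
    j' % 2 + (j' / 2) * 2          ≡⟨ cong₂ (λ r q → r + q * 2) (≡-sym lowestBit) j'/2≡ ⟩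
    j % 2 + (j / 2 + t * 2 ^ k) * 2 ≡⟨ regroup (j % 2) (j / 2) t (2 ^ k) ⟩
    (j % 2 + (j / 2) * 2) + t * 2 ^ suc k ≡⟨ cong (_+ t * 2 ^ suc k) (≡-sym (m≡m%n+[m/n]*n j 2)) ⟩
    j + t * 2 ^ suc k              ∎)
  where
  open ≡-Reasoning
  lowestBit : j % 2 ≡ j' % 2
  lowestBit = agree 1 (s≤s z≤n) (s≤s z≤n)
  regroup : ∀ r q t p → r + (q + t * p) * 2 ≡ (r + q * 2) + t * (p + (p + 0))
  regroup = solve-∀

-- Two numbers in the window [1, 2^k] that agree on their lowest k bits are
-- equal: a nonzero multiple of 2^k added to j ≥ 1 leaves the window.
agree⇒equal≤ : ∀ k j j' → 1 ≤ j → j' ≤ 2 ^ k → AgreeBelow k j j' → j ≤ j' → j ≡ j'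
agree⇒equal≤ k j j' 1≤j j'≤2^k agree j≤j' with agree⇒congruent k j j' agree j≤j'
... | zero , j'≡ = trans (≡-sym (+-identityʳ j)) (≡-sym j'≡)
... | suc t , j'≡ = ⊥-elim (<⇒≱ (≤-trans leaves (≤-reflexive (≡-sym j'≡))) j'≤2^k)
  where
  leaves : 2 ^ k < j + suc t * 2 ^ k
  leaves = +-mono-≤ 1≤j (m≤m+n (2 ^ k) (t * 2 ^ k))

agree⇒equal : ∀ k j j' → 1 ≤ j → 1 ≤ j' → j ≤ 2 ^ k → j' ≤ 2 ^ k →
  AgreeBelow k j j' → j ≡ j'
agree⇒equal k j j' 1≤j 1≤j' j≤2^k j'≤2^k agree with ≤-total j j'
... | inj₁ j≤j' = agree⇒equal≤ k j j' 1≤j j'≤2^k agree j≤j'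
... | inj₂ j'≤j = ≡-sym (agree⇒equal≤ k j' j 1≤j' j≤2^k (λ i 1≤i i≤k → ≡-sym (agree i 1≤i i≤k)) j'≤j)

-- If 2x and 2y are at distance at most 1 then x = y (the distance is even).
close-doubles-equal : ∀ x y → ∣ 2 * x - 2 * y ∣ ≤ 1 → x ≡ y
close-doubles-equal x y close with ∣ x - y ∣ in dist
... | zero = ∣m-n∣≡0⇒m≡n dist
... | suc d = ⊥-elim (1+n≰n (≤-trans atLeast2 close))
  where
  atLeast2 : 2 ≤ ∣ 2 * x - 2 * y ∣
  atLeast2 = begin
    2 * 1          ≤⟨ *-monoʳ-≤ 2 (s≤s z≤n) ⟩
    2 * suc d      ≡⟨ cong (2 *_) dist ⟨
    2 * ∣ x - y ∣  ≡⟨ *-distribˡ-∣-∣ 2 x y ⟩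
    ∣ 2 * x - 2 * y ∣ ∎
    where open ≤-Reasoning

g-on-B : ∀ {n₁ n₂} i (b : Fin n₂) → g {n₁} i (inj₂ b) ≡ 2 * bit i (suc (toℕ b))
g-on-B i b with bit i (suc (toℕ b)) | bit<2 i (suc (toℕ b))
... | zero | _ = refl
... | suc zero | _ = refl
... | suc (suc _) | s≤s (s≤s ())

-- A vertex of A (value 1) is within distance 1 of any vertex of B (value 0 or 2).
A-B-close : ∀ {n₁ n₂} i (a : Fin n₁) (b : Fin n₂) →
  ∣ g {n₁} {n₂} i (inj₁ a) - g {n₁} {n₂} i (inj₂ b) ∣ ≤ 1
A-B-close i a b with bit i (suc (toℕ b))
... | zero = ≤-refl
... | suc _ = ≤-refl

edge-distinct : ∀ {X : Set} (G : Graph X) {x y : X} → Adj G x y → x ≢ y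
edge-distinct G e refl = irrefl G e

-- Every edge of a bipartite graph joins A to B, so it lies in every J_i.
edge⇒JAdj : ∀ {n₁ n₂} (G : Graph (V n₁ n₂)) → IsBipartiteAB G →
  ∀ i {x y} → Adj G x y → JAdj i x y
edge⇒JAdj {n₁} {n₂} G (noEdgeInA , noEdgeInB) i {x} {y} e = edge-distinct G e , close x y e
  where
  close : ∀ x y → Adj G x y → ∣ g i x - g i y ∣ ≤ 1
  close (inj₁ a) (inj₁ a') e = ⊥-elim (noEdgeInA a a' e)
  close (inj₁ a) (inj₂ b) _ = A-B-close i a b
  close (inj₂ b) (inj₁ a) _ = subst (_≤ 1) (∣-∣-comm (g {n₁} {n₂} i (inj₁ a)) (g {n₁} {n₂} i (inj₂ b))) (A-B-close i a b)
  close (inj₂ b) (inj₂ b') e = ⊥-elim (noEdgeInB b b' e)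

-- An H₂-edge between u_j and u_j' forces j and j' to agree on their lowest
-- ⌈log₂ n₂⌉ bits, since each J_i with g_i ∈ {0, 2} on B compares bit i.
H₂-edge-in-B⇒agree : ∀ {n₁ n₂} (b b' : Fin n₂) → H₂Adj {n₁} {n₂} (inj₂ b) (inj₂ b') →
  AgreeBelow ⌈log₂ n₂ ⌉ (suc (toℕ b)) (suc (toℕ b'))
H₂-edge-in-B⇒agree {n₁} b b' (_ , inAllJ) i 1≤i i≤k with inAllJ i 1≤i i≤k
... | _ , close = close-doubles-equal _ _
  (subst (_≤ 1) (cong₂ ∣_-_∣ (g-on-B {n₁} i b) (g-on-B {n₁} i b')) close)

index≤2^⌈log₂⌉ : ∀ {n} (b : Fin n) → suc (toℕ b) ≤ 2 ^ ⌈log₂ n ⌉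
index≤2^⌈log₂⌉ {n} b = ≤-trans (toℕ<n b) (n≤2^⌈log₂n⌉ n)

lemma3p4 : (n₁ n₂ : ℕ) (G : Graph (V n₁ n₂)) → IsBipartiteAB G →
    IsSupergraphOf (H₂Adj {n₁} {n₂}) G ×
    (∀ (b b' : Fin n₂) → b ≢ b' → ¬ H₂Adj {n₁} {n₂} (inj₂ b) (inj₂ b'))
lemma3p4 n₁ n₂ G bipartite = supergraph , independentB
  where
  supergraph : IsSupergraphOf (H₂Adj {n₁} {n₂}) G
  supergraph x y e = edge-distinct G e , λ i _ _ → edge⇒JAdj G bipartite i e

  independentB : ∀ (b b' : Fin n₂) → b ≢ b' → ¬ H₂Adj {n₁} {n₂} (inj₂ b) (inj₂ b')
  independentB b b' b≢b' h = b≢b' (toℕ-injective (suc-injective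
    (agree⇒equal ⌈log₂ n₂ ⌉ (suc (toℕ b)) (suc (toℕ b')) (s≤s z≤n) (s≤s z≤n)
      (index≤2^⌈log₂⌉ b) (index≤2^⌈log₂⌉ b') (H₂-edge-in-B⇒agree b b' h))))
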